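{- Let $S_n(1\to n)$ be the set of $\sigma\in S_n$ in which $1$ appears to the left of $n$, and $B_n^{(1,0,1,1)}(x)=\sum_{\sigma\in S_n(1\to n)}x^{mmp^{(1,0,1,1)}(\sigma)}$. Then \[ B^{(1,0,1,1)}(t,x):=\sum_{n\ge2}B_n^{(1,0,1,1)}(x)\frac{t^{n-2}}{(n-2)!}=(1-tx)^{ -3/x}=1+3t+\sum_{m\ge2}\frac{t^m}{m!}\prod_{i=0}^{m-1}(3+ix). \]
   Context: For $\sigma=\sigma_1\cdots\sigma_n\in S_n$, $\sigma_i$ matches $MMP(1,0,1,1)$ if there is some $j>i$ with $\sigma_j>\sigma_i$, some $j<i$ with $\sigma_j<\sigma_i$, and some $j>i$ with $\sigma_j<\sigma_i$. $mmp^{(1,0,1,1)}(\sigma)$ is the number of such $i$. -}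

module Defs where

open import Data.Bool using (Bool; true; false; _∧_; not; if_then_else_)
open import Data.Nat using (ℕ; zero; suc; _+_; _*_; _^_; _<ᵇ_; _≡ᵇ_)
open import Data.List using (List; []; _∷_; _++_; [_]; map; concatMap; upTo; filterᵇ)
open import Data.Bool.ListAction using (any)
open import Data.Nat.ListAction using (sum; product)

words : ℕ → ℕ → List (List ℕ)
words zero    n = [] ∷ []
words (suc k) n = concatMap (λ w → map (λ a → a ∷ w) (map suc (upTo n))) (words k n)

distinct : List ℕ → Bool
distinct []      = true
distinct (a ∷ w) = not (any (λ b → a ≡ᵇ b) w) ∧ distinct w

Sn : ℕ → List (List ℕ)
Sn n = filterᵇ distinct (words n n)

oneBefore : ℕ → List ℕ → Bool
oneBefore n []      = false
oneBefore n (a ∷ w) = if a ≡ᵇ 1 then true else (if a ≡ᵇ n then false else oneBefore n w)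

Sn1n : ℕ → List (List ℕ)
Sn1n n = filterᵇ (oneBefore n) (Sn n)

-- σ_i matches MMP(1,0,1,1): smaller letter to the left, larger and smaller letters to the right.
matches : List ℕ → ℕ → List ℕ → Bool
matches pre a suf = any (λ b → b <ᵇ a) pre ∧ (any (λ b → a <ᵇ b) suf ∧ any (λ b → b <ᵇ a) suf)

mmpGo : List ℕ → List ℕ → ℕ
mmpGo pre []      = 0
mmpGo pre (a ∷ s) = (if matches pre a s then 1 else 0) + mmpGo (pre ++ [ a ]) s

mmp : List ℕ → ℕ
mmp σ = mmpGo [] σ

B : ℕ → ℕ → ℕ
B n x = sum (map (λ σ → x ^ mmp σ) (Sn1n n))

rhsProd : ℕ → ℕ → ℕ
rhsProd m x = product (map (λ i → 3 + i * x) (upTo m))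

module Submission where

-- Write σ ∈ S_n(1 → n) as P ++ 1 ∷ W. Every entry of P has 1 and n to its right, so it matches iff it
-- is not a left-to-right minimum of P; 1 never matches; every entry of W has 1 to its left, so it
-- matches iff W has both a larger and a smaller entry to its right. Choosing the entries of a
-- permutation one at a time (from the right for P, from the left for W) shows that the weighted sum
-- over the arrangements of a u-set before 1 is ∏_{i<u} (1 + i x), and over the arrangements of a
-- (c+1)-set after 1 (containing n) is ∏_{i<c} (2 + i x). Summing over the ways to split
-- {2, …, n−1} into the entries before and after 1, the smallest of them on either side contributes
-- (1 + u x) + (2 + c x) = 3 + (u + c) x, so the total is ∏_{i<n−2} (3 + i x).

open import Defs
open import Data.Bool using (Bool; true; false; _∧_; _∨_; if_then_else_; T)
open import Data.Bool.Properties using (∨-comm; ∨-assoc; ∧-zeroʳ; ∧-identityʳ; T-≡; T?)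
open import Data.Nat using (ℕ; zero; suc; _+_; _*_; _^_; _<ᵇ_; _≡ᵇ_; _≤_; _<_; s≤s; z≤n; _≟_)
open import Data.Nat.Properties
open import Data.Nat.Tactic.RingSolver using (solve-∀)
open import Data.List using (List; []; _∷_; head; _++_; [_]; map; concatMap; upTo; filter; length; reverse; applyUpTo)
open import Data.List.Properties
  using (map-++; map-∘; map-id; map-cong-local; length-map; length-++; length-upTo; ++-assoc; ++-identityʳ;
         ∷-injectiveˡ; ∷-injectiveʳ; ++-cancelˡ; reverse-injective; reverse-involutive; unfold-reverse;
         map-upTo; applyUpTo-∷ʳ; length-applyUpTo; upTo-∷ʳ; filter-++; filter-all; filter-none; filter-accept; filter-reject)
open import Data.Bool.ListAction using (any)
open import Data.Nat.ListAction using (sum; product)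
open import Data.Nat.ListAction.Properties using (sum-++; sum-↭; product-++)
open import Data.List.Membership.Propositional using (_∈_; _∉_; lose; find)
open import Data.List.Membership.Propositional.Properties
  using (∈-map⁺; ∈-map⁻; ∈-applyUpTo⁻; ∈-++⁺ˡ; ∈-++⁺ʳ; ∈-++⁻; ∈-∃++; ∈-concatMap⁺; ∈-concatMap⁻;
         ∈-filter⁺; ∈-filter⁻)
open import Data.List.Membership.DecPropositional _≟_ using (_∈?_)
open import Data.List.Membership.Propositional.Properties.WithK using (unique∧set⇒bag)
open import Data.List.Relation.Unary.Any using (here; there)
open import Data.List.Relation.Unary.Any.Properties using (any⁺)
open import Data.List.Relation.Unary.All using (All; []; _∷_)
import Data.List.Relation.Unary.All as All
open import Data.List.Relation.Unary.AllPairs using (AllPairs; []; _∷_)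
import Data.List.Relation.Unary.AllPairs as AllPairs
import Data.List.Relation.Unary.AllPairs.Properties as AllPairs
open import Data.List.Relation.Unary.Unique.Propositional using (Unique)
import Data.List.Relation.Unary.Unique.Propositional.Properties as Unique
open import Data.List.Relation.Binary.Permutation.Propositional
  using (_↭_; ↭-refl; ↭-sym; ↭-trans; ↭-prep; ↭-swap; ↭⇒↭ₛ)
import Data.List.Relation.Binary.Permutation.Propositional as ↭
open import Data.List.Relation.Binary.Permutation.Propositional.Properties
  using (↭-length; ↭-empty-inv; drop-∷; ∈-resp-↭; ↭-reverse; shift; filter-↭; ++⁺; ++⁺ʳ; map⁺)
import Data.List.Relation.Binary.Permutation.Setoid.Properties as ↭ₛ
open import Data.List.Relation.Binary.BagAndSetEquality using (∼bag⇒↭)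
open import Data.Product using (∃; ∃₂; _×_; _,_; proj₁; proj₂; map₁; map₂)
open import Data.Sum using (_⊎_; inj₁; inj₂)
open import Data.Empty using (⊥-elim)
open import Data.Maybe using (just)
open import Data.Maybe.Properties using (just-injective)
open import Function using (_∘_; id; _⇔_; mk⇔; Equivalence)
open import Relation.Nullary using (¬_; yes; no)
open import Relation.Nullary.Decidable using (¬?)
open import Relation.Unary using (Decidable)
open import Relation.Binary.PropositionalEquality
  using (_≡_; _≢_; refl; sym; trans; cong; cong₂; subst; setoid; module ≡-Reasoning)

variable
  A X K : Set

sum-map-++ : (f : A → ℕ) (xs ys : List A) → sum (map f (xs ++ ys)) ≡ sum (map f xs) + sum (map f ys)
sum-map-++ f xs ys = trans (cong sum (map-++ f xs ys)) (sum-++ (map f xs) (map f ys))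

sum-map-concatMap : (f : X → ℕ) (g : A → List X) (xs : List A) →
                    sum (map f (concatMap g xs)) ≡ sum (map (λ a → sum (map f (g a))) xs)
sum-map-concatMap f g []       = refl
sum-map-concatMap f g (x ∷ xs) =
  trans (sum-map-++ f (g x) (concatMap g xs)) (cong (sum (map f (g x)) +_) (sum-map-concatMap f g xs))

sum-map-cong : (f g : A → ℕ) {xs : List A} → (∀ {a} → a ∈ xs → f a ≡ g a) → sum (map f xs) ≡ sum (map g xs)
sum-map-cong f g f≡g = cong sum (map-cong-local (All.tabulate f≡g))

sum-map-*ˡ : (c : ℕ) (f : A → ℕ) (xs : List A) → sum (map (λ a → c * f a) xs) ≡ c * sum (map f xs)
sum-map-*ˡ c f []       = sym (*-zeroʳ c)
sum-map-*ˡ c f (x ∷ xs) = trans (cong (c * f x +_) (sum-map-*ˡ c f xs)) (sym (*-distribˡ-+ c (f x) _))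

sum-map-+ : (f g : A → ℕ) (xs : List A) → sum (map (λ a → f a + g a) xs) ≡ sum (map f xs) + sum (map g xs)
sum-map-+ f g []       = refl
sum-map-+ f g (x ∷ xs) = trans (cong (f x + g x +_) (sum-map-+ f g xs)) (interchange (f x) (g x) _ _)
  where
  interchange : ∀ a b c d → a + b + (c + d) ≡ a + c + (b + d)
  interchange = solve-∀

sum-map-const : (c : ℕ) (xs : List A) → sum (map (λ _ → c) xs) ≡ length xs * c
sum-map-const c []       = refl
sum-map-const c (_ ∷ xs) = cong (c +_) (sum-map-const c xs)

Unique-resp-↭ : {xs ys : List A} → xs ↭ ys → Unique xs → Unique ys
Unique-resp-↭ p = ↭ₛ.Unique-resp-↭ (setoid _) (↭⇒↭ₛ p)

Unique-++⇒disjoint : (xs : List A) {ys : List A} → Unique (xs ++ ys) → ∀ {a} → a ∈ xs → a ∉ ys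
Unique-++⇒disjoint (x ∷ xs) (x∉ ∷ _) (here refl) a∈ys = All.lookup x∉ (∈-++⁺ʳ xs a∈ys) refl
Unique-++⇒disjoint (x ∷ xs) (_ ∷ u)  (there a∈xs) = Unique-++⇒disjoint xs u a∈xs

↭-of-Unique : {xs ys : List A} → Unique xs → Unique ys → (∀ {a} → a ∈ xs ⇔ a ∈ ys) → xs ↭ ys
↭-of-Unique uxs uys same = ∼bag⇒↭ (unique∧set⇒bag uxs uys same)

Unique-concatMap⁺ : (g : A → List X) (key : X → K) (label : A → K) {xs : List A} →
                    Unique (map label xs) → (∀ {a} → a ∈ xs → Unique (g a)) →
                    (∀ {a b} → a ∈ xs → b ∈ g a → key b ≡ label a) → Unique (concatMap g xs)
Unique-concatMap⁺ g key label {[]}     _         _      _      = []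
Unique-concatMap⁺ g key label {x ∷ xs} (x∉ ∷ u) uBlock keyed =
  Unique.++⁺ (uBlock (here refl)) (Unique-concatMap⁺ g key label u (uBlock ∘ there) (keyed ∘ there)) disjoint
  where
  disjoint : ∀ {b} → ¬ (b ∈ g x × b ∈ concatMap g xs)
  disjoint (b∈gx , b∈rest) with y , y∈xs , b∈gy ← find (∈-concatMap⁻ g {xs = xs} b∈rest) =
    All.lookup x∉ (∈-map⁺ label y∈xs) (trans (sym (keyed (here refl) b∈gx)) (keyed (there y∈xs) b∈gy))

indicator : Bool → ℕ
indicator b = if b then 1 else 0

<ᵇ-true : ∀ {a b} → a < b → (a <ᵇ b) ≡ true
<ᵇ-true a<b = Equivalence.to T-≡ (<⇒<ᵇ a<b)

<ᵇ-false : ∀ {a b} → b ≤ a → (a <ᵇ b) ≡ false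
<ᵇ-false {a} {b} b≤a with a <ᵇ b in eq
... | false = refl
... | true  = ⊥-elim (<⇒≱ (<ᵇ⇒< a b (Equivalence.from T-≡ eq)) b≤a)

≡ᵇ-false : ∀ {a b} → a ≢ b → (a ≡ᵇ b) ≡ false
≡ᵇ-false {a} {b} a≢b with a ≡ᵇ b in eq
... | false = refl
... | true  = ⊥-elim (a≢b (≡ᵇ⇒≡ a b (Equivalence.from T-≡ eq)))

≡ᵇ-refl : ∀ a → (a ≡ᵇ a) ≡ true
≡ᵇ-refl a = Equivalence.to T-≡ (≡⇒≡ᵇ a a refl)

any-true : (p : A → Bool) (xs : List A) {a : A} → a ∈ xs → p a ≡ true → any p xs ≡ true
any-true p xs a∈xs pa = Equivalence.to T-≡ (any⁺ p (lose a∈xs (Equivalence.from T-≡ pa)))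

any-false : (p : A → Bool) {xs : List A} → (∀ {a} → a ∈ xs → p a ≡ false) → any p xs ≡ false
any-false p {[]}     _   = refl
any-false p {x ∷ xs} ¬px rewrite ¬px (here refl) = any-false p (¬px ∘ there)

any-resp-↭ : (p : A → Bool) {xs ys : List A} → xs ↭ ys → any p xs ≡ any p ys
any-resp-↭ p ↭.refl                        = refl
any-resp-↭ p (↭.prep x xs↭ys)              = cong (p x ∨_) (any-resp-↭ p xs↭ys)
any-resp-↭ p (↭.swap {xs} {ys} x y xs↭ys) = begin
  p x ∨ (p y ∨ any p xs)  ≡⟨ ∨-assoc (p x) (p y) (any p xs) ⟨
  (p x ∨ p y) ∨ any p xs  ≡⟨ cong (_∨ any p xs) (∨-comm (p x) (p y)) ⟩
  (p y ∨ p x) ∨ any p xs  ≡⟨ ∨-assoc (p y) (p x) (any p xs) ⟩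
  p y ∨ (p x ∨ any p xs)  ≡⟨ cong (λ b → p y ∨ (p x ∨ b)) (any-resp-↭ p xs↭ys) ⟩
  p y ∨ (p x ∨ any p ys)  ∎
  where open ≡-Reasoning
any-resp-↭ p (↭.trans xs↭ys ys↭zs)        = trans (any-resp-↭ p xs↭ys) (any-resp-↭ p ys↭zs)

select : List A → List (A × List A)
select []      = []
select (a ∷ V) = (a , V) ∷ map (map₂ (a ∷_)) (select V)

select-↭ : ∀ V {v : A} {r} → (v , r) ∈ select V → V ↭ v ∷ r
select-↭ (a ∷ V) (here refl) = ↭-refl
select-↭ (a ∷ V) (there vr∈) with (v , r) , vr∈′ , refl ← ∈-map⁻ (map₂ (a ∷_)) vr∈ =
  ↭-trans (↭-prep a (select-↭ V vr∈′)) (↭-swap a v ↭-refl)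

∈-select : ∀ {V} {v : A} → v ∈ V → ∃ λ r → (v , r) ∈ select V
∈-select {V = a ∷ V} (here refl) = V , here refl
∈-select {V = a ∷ V} (there v∈V) with r , vr∈ ← ∈-select v∈V = a ∷ r , there (∈-map⁺ (map₂ (a ∷_)) vr∈)

map-proj₁-select : (V : List A) → map proj₁ (select V) ≡ V
map-proj₁-select []      = refl
map-proj₁-select (a ∷ V) = cong (a ∷_) (trans (sym (map-∘ (select V))) (map-proj₁-select V))

length-select : (V : List A) → length (select V) ≡ length V
length-select V = trans (sym (length-map proj₁ (select V))) (cong length (map-proj₁-select V))

-- The fuel k equals the length of the list being permuted; it makes the recursion structural.
permutationsOfLength : ℕ → List A → List (List A)
permutationsOfLength zero    V = [ [] ]
permutationsOfLength (suc k) V = concatMap (λ (v , r) → map (v ∷_) (permutationsOfLength k r)) (select V)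

permutations : List A → List (List A)
permutations V = permutationsOfLength (length V) V

length-remainder : ∀ {k} V {v : A} {r} → length V ≡ suc k → (v , r) ∈ select V → length r ≡ k
length-remainder V |V| vr∈ = suc-injective (trans (sym (↭-length (select-↭ V vr∈))) |V|)

∈-permutationsOfLength⁻ : ∀ k (V : List A) {σ} → length V ≡ k → σ ∈ permutationsOfLength k V → σ ↭ V
∈-permutationsOfLength⁻ zero    [] |V| (here refl) = ↭-refl
∈-permutationsOfLength⁻ (suc k) V  |V| σ∈
  with (v , r) , vr∈ , σ∈′ ← find (∈-concatMap⁻ _ {xs = select V} σ∈)
  with ρ , ρ∈ , refl ← ∈-map⁻ (v ∷_) σ∈′ =
  ↭-trans (↭-prep v (∈-permutationsOfLength⁻ k r (length-remainder V |V| vr∈) ρ∈)) (↭-sym (select-↭ V vr∈))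

∈-permutationsOfLength⁺ : ∀ k (V : List A) {σ} → length V ≡ k → σ ↭ V → σ ∈ permutationsOfLength k V
∈-permutationsOfLength⁺ zero    [] |V| σ↭V rewrite ↭-empty-inv σ↭V = here refl
∈-permutationsOfLength⁺ (suc k) V  {[]}    |V| σ↭V with () ← trans (↭-length σ↭V) |V|
∈-permutationsOfLength⁺ (suc k) V  {v ∷ ρ} |V| σ↭V
  with r , vr∈ ← ∈-select (∈-resp-↭ σ↭V (here refl)) =
  ∈-concatMap⁺ _ {xs = select V} (lose vr∈ (∈-map⁺ (v ∷_)
    (∈-permutationsOfLength⁺ k r (length-remainder V |V| vr∈) (drop-∷ (↭-trans σ↭V (select-↭ V vr∈))))))

Unique-permutationsOfLength : ∀ k {V : List A} → Unique V → Unique (permutationsOfLength k V)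
Unique-permutationsOfLength zero    uV = [] ∷ []
Unique-permutationsOfLength (suc k) {V} uV =
  Unique-concatMap⁺ _ head (just ∘ proj₁) heads-Unique
    (λ vr∈ → Unique.map⁺ ∷-injectiveʳ
               (Unique-permutationsOfLength k (tail-Unique (Unique-resp-↭ (select-↭ V vr∈) uV))))
    (λ _ σ∈ → head-∷ σ∈)
  where
  heads-Unique : Unique (map (just ∘ proj₁) (select V))
  heads-Unique = subst Unique (sym (trans (map-∘ (select V)) (cong (map just) (map-proj₁-select V))))
                   (Unique.map⁺ just-injective uV)
  tail-Unique : ∀ {v : A} {r} → Unique (v ∷ r) → Unique r
  tail-Unique (_ ∷ u) = u
  head-∷ : ∀ {v : A} {ρs σ} → σ ∈ map (v ∷_) ρs → head σ ≡ just v
  head-∷ σ∈ with _ , _ , refl ← ∈-map⁻ _ σ∈ = refl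

∈-permutations⁻ : {V σ : List A} → σ ∈ permutations V → σ ↭ V
∈-permutations⁻ {V = V} = ∈-permutationsOfLength⁻ (length V) V refl

∈-permutations⁺ : {V σ : List A} → σ ↭ V → σ ∈ permutations V
∈-permutations⁺ {V = V} = ∈-permutationsOfLength⁺ (length V) V refl

Unique-permutations : {V : List A} → Unique V → Unique (permutations V)
Unique-permutations {V = V} = Unique-permutationsOfLength (length V)

sum-permutationsOfLength-suc :
  (f : List A → ℕ) (c : A × List A → ℕ) → (∀ {v ρ r} → ρ ↭ r → f (v ∷ ρ) ≡ c (v , r) * f ρ) →
  ∀ k V (F : ℕ) → length V ≡ suc k →
  (∀ {v r} → (v , r) ∈ select V → sum (map f (permutationsOfLength k r)) ≡ F) →
  sum (map f (permutationsOfLength (suc k) V)) ≡ F * sum (map c (select V))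
sum-permutationsOfLength-suc f c peel k V F |V| sumRest = begin
  sum (map f (permutationsOfLength (suc k) V))
    ≡⟨ sum-map-concatMap f _ (select V) ⟩
  sum (map (λ (v , r) → sum (map f (map (v ∷_) (permutationsOfLength k r)))) (select V))
    ≡⟨ sum-map-cong _ (λ vr → F * c vr) byFirstLetter ⟩
  sum (map (λ vr → F * c vr) (select V))
    ≡⟨ sum-map-*ˡ F c (select V) ⟩
  F * sum (map c (select V)) ∎
  where
  open ≡-Reasoning
  byFirstLetter : ∀ {vr} → vr ∈ select V → sum (map f (map (proj₁ vr ∷_) (permutationsOfLength k (proj₂ vr)))) ≡ F * c vr
  byFirstLetter {v , r} vr∈ = begin
    sum (map f (map (v ∷_) (permutationsOfLength k r)))  ≡⟨ cong sum (map-∘ (permutationsOfLength k r)) ⟨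
    sum (map (f ∘ (v ∷_)) (permutationsOfLength k r))    ≡⟨ sum-map-cong _ (λ ρ → c (v , r) * f ρ)
                                                              (peel ∘ ∈-permutationsOfLength⁻ k r (length-remainder V |V| vr∈)) ⟩
    sum (map (λ ρ → c (v , r) * f ρ) (permutationsOfLength k r))  ≡⟨ sum-map-*ˡ (c (v , r)) f (permutationsOfLength k r) ⟩
    c (v , r) * sum (map f (permutationsOfLength k r))   ≡⟨ cong (c (v , r) *_) (sumRest vr∈) ⟩
    c (v , r) * F                                          ≡⟨ *-comm (c (v , r)) F ⟩
    F * c (v , r)                                          ∎

Sorted : List ℕ → Set
Sorted = AllPairs _<_

Sorted⇒Unique : ∀ {V} → Sorted V → Unique V
Sorted⇒Unique = AllPairs.map <⇒≢

∈-select⇒∈ : ∀ V {v : A} {r} → (v , r) ∈ select V → v ∈ V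
∈-select⇒∈ V vr∈ = ∈-resp-↭ (↭-sym (select-↭ V vr∈)) (here refl)

select-Sorted : ∀ V {v r} → Sorted V → (v , r) ∈ select V → Sorted r
select-Sorted (a ∷ V) (_ ∷ sV) (here refl) = sV
select-Sorted (a ∷ V) (a<V ∷ sV) (there vr∈) with (v , r) , vr∈′ , refl ← ∈-map⁻ _ vr∈ =
  All.tabulate (λ b∈r → All.lookup a<V (∈-resp-↭ (↭-sym (select-↭ V vr∈′)) (there b∈r))) ∷ select-Sorted V sV vr∈′

module _ (x : ℕ) where

  smallerWeight largerWeight sandwichWeight : ℕ × List ℕ → ℕ
  smallerWeight  (v , r) = x ^ indicator (any (λ b → b <ᵇ v) r)
  largerWeight   (v , r) = x ^ indicator (any (λ b → v <ᵇ b) r)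
  sandwichWeight (v , r) = x ^ indicator (any (λ b → v <ᵇ b) r ∧ any (λ b → b <ᵇ v) r)

  -- Only the first choice (the minimum) has no smaller letter among the rest.
  sum-smallerWeight : ∀ a V → Sorted (a ∷ V) → sum (map smallerWeight (select (a ∷ V))) ≡ 1 + length V * x
  sum-smallerWeight a V (a<V ∷ _) = cong₂ _+_ minimumWeight (begin
    sum (map smallerWeight (map (map₂ (a ∷_)) (select V)))  ≡⟨ cong sum (map-∘ (select V)) ⟨
    sum (map (smallerWeight ∘ map₂ (a ∷_)) (select V))      ≡⟨ sum-map-cong _ (λ _ → x) weightX ⟩
    sum (map (λ _ → x) (select V))                          ≡⟨ sum-map-const x (select V) ⟩
    length (select V) * x                                   ≡⟨ cong (_* x) (length-select V) ⟩
    length V * x                                            ∎)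
    where
    open ≡-Reasoning
    minimumWeight : smallerWeight (a , V) ≡ 1
    minimumWeight rewrite any-false (λ b → b <ᵇ a) (<ᵇ-false ∘ <⇒≤ ∘ All.lookup a<V) = refl
    weightX : ∀ {vr} → vr ∈ select V → smallerWeight (proj₁ vr , a ∷ proj₂ vr) ≡ x
    weightX {v , r} vr∈ rewrite <ᵇ-true (All.lookup a<V (∈-select⇒∈ V vr∈)) = *-identityʳ x

  -- Only the last choice (the maximum) has no larger letter among the rest.
  sum-largerWeight : ∀ a V → Sorted (a ∷ V) → sum (map largerWeight (select (a ∷ V))) ≡ 1 + length V * x
  sum-largerWeight a []      _                 = refl
  sum-largerWeight a (b ∷ V) (a<bV ∷ sbV) = begin
    largerWeight (a , b ∷ V) + sum (map largerWeight (map (map₂ (a ∷_)) (select (b ∷ V))))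
      ≡⟨ cong₂ _+_ nonMaximumWeight (sym (cong sum (map-∘ (select (b ∷ V))))) ⟩
    x + sum (map (largerWeight ∘ map₂ (a ∷_)) (select (b ∷ V)))
      ≡⟨ cong (x +_) (sum-map-cong _ largerWeight smallerPrefixIgnored) ⟩
    x + sum (map largerWeight (select (b ∷ V)))
      ≡⟨ cong (x +_) (sum-largerWeight b V sbV) ⟩
    x + (1 + length V * x)
      ≡⟨ +-assoc x 1 (length V * x) ⟨
    x + 1 + length V * x
      ≡⟨ cong (_+ length V * x) (+-comm x 1) ⟩
    1 + length (b ∷ V) * x ∎
    where
    open ≡-Reasoning
    nonMaximumWeight : largerWeight (a , b ∷ V) ≡ x
    nonMaximumWeight rewrite <ᵇ-true (All.lookup a<bV (here refl)) = *-identityʳ x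
    smallerPrefixIgnored : ∀ {vr} → vr ∈ select (b ∷ V) → largerWeight (proj₁ vr , a ∷ proj₂ vr) ≡ largerWeight vr
    smallerPrefixIgnored {v , r} vr∈ rewrite <ᵇ-false (<⇒≤ (All.lookup a<bV (∈-select⇒∈ (b ∷ V) vr∈))) = refl

  -- Choosing the minimum gives weight 1; otherwise the minimum stays behind, so the weight is the largerWeight.
  sum-sandwichWeight : ∀ a b V → Sorted (a ∷ b ∷ V) → sum (map sandwichWeight (select (a ∷ b ∷ V))) ≡ 2 + length V * x
  sum-sandwichWeight a b V (a<bV ∷ sbV) = cong₂ _+_ minimumWeight (begin
    sum (map sandwichWeight (map (map₂ (a ∷_)) (select (b ∷ V))))  ≡⟨ cong sum (map-∘ (select (b ∷ V))) ⟨
    sum (map (sandwichWeight ∘ map₂ (a ∷_)) (select (b ∷ V)))      ≡⟨ sum-map-cong _ largerWeight minimumBehind ⟩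
    sum (map largerWeight (select (b ∷ V)))                         ≡⟨ sum-largerWeight b V sbV ⟩
    1 + length V * x                                                 ∎)
    where
    open ≡-Reasoning
    minimumWeight : sandwichWeight (a , b ∷ V) ≡ 1
    minimumWeight rewrite any-false (λ c → c <ᵇ a) (<ᵇ-false ∘ <⇒≤ ∘ All.lookup a<bV)
                        | ∧-zeroʳ (any (λ c → a <ᵇ c) (b ∷ V)) = refl
    minimumBehind : ∀ {vr} → vr ∈ select (b ∷ V) → sandwichWeight (proj₁ vr , a ∷ proj₂ vr) ≡ largerWeight vr
    minimumBehind {v , r} vr∈ rewrite <ᵇ-false (<⇒≤ (All.lookup a<bV (∈-select⇒∈ (b ∷ V) vr∈)))
                                    | <ᵇ-true (All.lookup a<bV (∈-select⇒∈ (b ∷ V) vr∈))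
                                    | ∧-identityʳ (any (λ c → v <ᵇ c) r) = refl

rightSandwiched : List ℕ → ℕ
rightSandwiched []      = 0
rightSandwiched (a ∷ s) = indicator (any (λ b → a <ᵇ b) s ∧ any (λ b → b <ᵇ a) s) + rightSandwiched s

nonLeftMinima : List ℕ → List ℕ → ℕ
nonLeftMinima pre []      = 0
nonLeftMinima pre (a ∷ s) = indicator (any (λ b → b <ᵇ a) pre) + nonLeftMinima (pre ++ [ a ]) s

nonLeftMinima-∷ʳ : ∀ pre τ v →
  nonLeftMinima pre (τ ++ [ v ]) ≡ nonLeftMinima pre τ + indicator (any (λ b → b <ᵇ v) (pre ++ τ))
nonLeftMinima-∷ʳ pre []      v rewrite ++-identityʳ pre = +-identityʳ _
nonLeftMinima-∷ʳ pre (a ∷ τ) v rewrite nonLeftMinima-∷ʳ (pre ++ [ a ]) τ v | ++-assoc pre [ a ] τ =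
  sym (+-assoc (indicator (any (λ b → b <ᵇ a) pre)) _ _)

rising : ℕ → ℕ → ℕ → ℕ
rising c x zero    = 1
rising c x (suc k) = (c + k * x) * rising c x k

rising-product : ∀ c x k → product (map (λ i → c + i * x) (upTo k)) ≡ rising c x k
rising-product c x zero    = refl
rising-product c x (suc k) = begin
  product (map f (upTo (suc k)))          ≡⟨ cong (product ∘ map f) (upTo-∷ʳ k) ⟨
  product (map f (upTo k ++ [ k ]))       ≡⟨ cong product (map-++ f (upTo k) [ k ]) ⟩
  product (map f (upTo k) ++ [ f k ])     ≡⟨ product-++ (map f (upTo k)) [ f k ] ⟩
  product (map f (upTo k)) * (f k * 1)    ≡⟨ cong₂ _*_ (rising-product c x k) (*-identityʳ (f k)) ⟩
  rising c x k * f k                      ≡⟨ *-comm (rising c x k) (f k) ⟩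
  rising c x (suc k)                      ∎
  where
  open ≡-Reasoning
  f : ℕ → ℕ
  f i = c + i * x

module _ (x : ℕ) where

  sum-rightSandwiched : ∀ k V → Sorted V → length V ≡ suc k →
    sum (map (λ W → x ^ rightSandwiched W) (permutationsOfLength (suc k) V)) ≡ rising 2 x k
  sum-rightSandwiched zero    (a ∷ [])    _  refl = refl
  sum-rightSandwiched (suc k) V@(a ∷ b ∷ V′) sV |V| = begin
    sum (map (λ W → x ^ rightSandwiched W) (permutationsOfLength (suc (suc k)) V))
      ≡⟨ sum-permutationsOfLength-suc _ (sandwichWeight x) peel (suc k) V (rising 2 x k) |V|
           (λ vr∈ → sum-rightSandwiched k _ (select-Sorted V sV vr∈) (length-remainder V |V| vr∈)) ⟩
    rising 2 x k * sum (map (sandwichWeight x) (select V))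
      ≡⟨ cong (rising 2 x k *_) (sum-sandwichWeight x a b V′ sV) ⟩
    rising 2 x k * (2 + length V′ * x)
      ≡⟨ *-comm (rising 2 x k) _ ⟩
    (2 + length V′ * x) * rising 2 x k
      ≡⟨ cong (λ l → (2 + l * x) * rising 2 x k) (suc-injective (suc-injective |V|)) ⟩
    rising 2 x (suc k) ∎
    where
    open ≡-Reasoning
    peel : ∀ {v ρ r} → ρ ↭ r → x ^ rightSandwiched (v ∷ ρ) ≡ sandwichWeight x (v , r) * x ^ rightSandwiched ρ
    peel {v} {ρ} {r} ρ↭r rewrite any-resp-↭ (λ b → v <ᵇ b) ρ↭r | any-resp-↭ (λ b → b <ᵇ v) ρ↭r =
      ^-distribˡ-+-* x (indicator (any (λ b → v <ᵇ b) r ∧ any (λ b → b <ᵇ v) r)) (rightSandwiched ρ)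

  sum-nonLeftMinima : ∀ k V → Sorted V → length V ≡ k →
    sum (map (λ ρ → x ^ nonLeftMinima [] (reverse ρ)) (permutationsOfLength k V)) ≡ rising 1 x k
  sum-nonLeftMinima zero    []           _  refl = refl
  sum-nonLeftMinima (suc k) V@(a ∷ V′) sV |V| = begin
    sum (map (λ ρ → x ^ nonLeftMinima [] (reverse ρ)) (permutationsOfLength (suc k) V))
      ≡⟨ sum-permutationsOfLength-suc _ (smallerWeight x) peel k V (rising 1 x k) |V|
           (λ vr∈ → sum-nonLeftMinima k _ (select-Sorted V sV vr∈) (length-remainder V |V| vr∈)) ⟩
    rising 1 x k * sum (map (smallerWeight x) (select V))
      ≡⟨ cong (rising 1 x k *_) (sum-smallerWeight x a V′ sV) ⟩
    rising 1 x k * (1 + length V′ * x)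
      ≡⟨ *-comm (rising 1 x k) _ ⟩
    (1 + length V′ * x) * rising 1 x k
      ≡⟨ cong (λ l → (1 + l * x) * rising 1 x k) (suc-injective |V|) ⟩
    rising 1 x (suc k) ∎
    where
    open ≡-Reasoning
    -- The first letter of ρ is the last letter of the reversed word.
    peel : ∀ {v ρ r} → ρ ↭ r →
           x ^ nonLeftMinima [] (reverse (v ∷ ρ)) ≡ smallerWeight x (v , r) * x ^ nonLeftMinima [] (reverse ρ)
    peel {v} {ρ} ρ↭r
      rewrite unfold-reverse v ρ | nonLeftMinima-∷ʳ [] (reverse ρ) v
            | ^-distribˡ-+-* x (nonLeftMinima [] (reverse ρ)) (indicator (any (λ b → b <ᵇ v) (reverse ρ)))
            | any-resp-↭ (λ b → b <ᵇ v) (↭-trans (↭-reverse ρ) ρ↭r) = *-comm (x ^ nonLeftMinima [] (reverse ρ)) _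

splits : List A → List (List A × List A)
splits []      = [ ([] , []) ]
splits (a ∷ L) = map (map₁ (a ∷_)) (splits L) ++ map (map₂ (a ∷_)) (splits L)

splits-↭ : ∀ L {U C : List A} → (U , C) ∈ splits L → U ++ C ↭ L
splits-↭ [] (here refl) = ↭-refl
splits-↭ (a ∷ L) UC∈ with ∈-++⁻ (map (map₁ (a ∷_)) (splits L)) UC∈
... | inj₁ UC∈ˡ with (U , C) , UC∈′ , refl ← ∈-map⁻ _ UC∈ˡ = ↭-prep a (splits-↭ L UC∈′)
... | inj₂ UC∈ʳ with (U , C) , UC∈′ , refl ← ∈-map⁻ _ UC∈ʳ = ↭-trans (shift a U C) (↭-prep a (splits-↭ L UC∈′))

splits-⊆ˡ : ∀ L {U C : List A} {a} → (U , C) ∈ splits L → a ∈ U → a ∈ L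
splits-⊆ˡ L UC∈ a∈U = ∈-resp-↭ (splits-↭ L UC∈) (∈-++⁺ˡ a∈U)

splits-⊆ʳ : ∀ L {U C : List A} {a} → (U , C) ∈ splits L → a ∈ C → a ∈ L
splits-⊆ʳ L {U} UC∈ a∈C = ∈-resp-↭ (splits-↭ L UC∈) (∈-++⁺ʳ U a∈C)

splits-Sorted : ∀ L {U C} → Sorted L → (U , C) ∈ splits L → Sorted U × Sorted C
splits-Sorted [] _ (here refl) = [] , []
splits-Sorted (a ∷ L) (a<L ∷ sL) UC∈ with ∈-++⁻ (map (map₁ (a ∷_)) (splits L)) UC∈
... | inj₁ UC∈ˡ with (U , C) , UC∈′ , refl ← ∈-map⁻ _ UC∈ˡ with sU , sC ← splits-Sorted L sL UC∈′ =
  All.tabulate (All.lookup a<L ∘ splits-⊆ˡ L UC∈′) ∷ sU , sC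
... | inj₂ UC∈ʳ with (U , C) , UC∈′ , refl ← ∈-map⁻ _ UC∈ʳ with sU , sC ← splits-Sorted L sL UC∈′ =
  sU , All.tabulate (All.lookup a<L ∘ splits-⊆ʳ L UC∈′) ∷ sC

Unique-splits : {L : List A} → Unique L → Unique (splits L)
Unique-splits {L = []}    _          = [] ∷ []
Unique-splits {L = a ∷ L} (a∉L ∷ uL) =
  Unique.++⁺ (Unique.map⁺ map₁-injective (Unique-splits uL)) (Unique.map⁺ map₂-injective (Unique-splits uL)) disjoint
  where
  map₁-injective : ∀ {p q} → map₁ (a ∷_) p ≡ map₁ (a ∷_) q → p ≡ q
  map₁-injective refl = refl
  map₂-injective : ∀ {p q} → map₂ (a ∷_) p ≡ map₂ (a ∷_) q → p ≡ q
  map₂-injective refl = refl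
  disjoint : ∀ {UC} → ¬ (UC ∈ map (map₁ (a ∷_)) (splits L) × UC ∈ map (map₂ (a ∷_)) (splits L))
  disjoint (UC∈ˡ , UC∈ʳ) with _ , _ , refl ← ∈-map⁻ _ UC∈ˡ with _ , UC∈′ , refl ← ∈-map⁻ _ UC∈ʳ =
    All.lookup a∉L (splits-⊆ˡ L UC∈′ (here refl)) refl

module _ {P : A → Set} (P? : Decidable P) where

  filter-∈-splits : ∀ L → (filter P? L , filter (¬? ∘ P?) L) ∈ splits L
  filter-∈-splits []      = here refl
  filter-∈-splits (a ∷ L) with P? a
  ... | yes _ = ∈-++⁺ˡ (∈-map⁺ (map₁ (a ∷_)) (filter-∈-splits L))
  ... | no  _ = ∈-++⁺ʳ (map (map₁ (a ∷_)) (splits L)) (∈-map⁺ (map₂ (a ∷_)) (filter-∈-splits L))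

  splits-filter-≡ : ∀ L {U C} → Unique L → (U , C) ∈ splits L → (∀ {a} → a ∈ L → P a ⇔ a ∈ U) →
                    (filter P? L , filter (¬? ∘ P?) L) ≡ (U , C)
  splits-filter-≡ []      _          (here refl) _ = refl
  splits-filter-≡ (a ∷ L) (a∉L ∷ uL) UC∈ P⇔∈U with ∈-++⁻ (map (map₁ (a ∷_)) (splits L)) UC∈
  ... | inj₁ UC∈ˡ with (U , C) , UC∈′ , refl ← ∈-map⁻ _ UC∈ˡ with P? a
  ...   | no ¬Pa = ⊥-elim (¬Pa (Equivalence.from (P⇔∈U (here refl)) (here refl)))
  ...   | yes _  = cong (map₁ (a ∷_)) (splits-filter-≡ L uL UC∈′ (λ b∈L → mk⇔
                     (drop-a b∈L ∘ Equivalence.to (P⇔∈U (there b∈L))) (Equivalence.from (P⇔∈U (there b∈L)) ∘ there)))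
    where
    drop-a : ∀ {b} → b ∈ L → b ∈ a ∷ U → b ∈ U
    drop-a b∈L (here refl) = ⊥-elim (All.lookup a∉L b∈L refl)
    drop-a b∈L (there b∈U) = b∈U
  splits-filter-≡ (a ∷ L) (a∉L ∷ uL) UC∈ P⇔∈U | inj₂ UC∈ʳ with (U , C) , UC∈′ , refl ← ∈-map⁻ _ UC∈ʳ with P? a
  ...   | yes Pa = ⊥-elim (All.lookup a∉L (splits-⊆ˡ L UC∈′ (Equivalence.to (P⇔∈U (here refl)) Pa)) refl)
  ...   | no  _  = cong (map₂ (a ∷_)) (splits-filter-≡ L uL UC∈′ (P⇔∈U ∘ there))

sum-splits : ∀ x (L : List A) →
  sum (map (λ (U , C) → rising 1 x (length U) * rising 2 x (length C)) (splits L)) ≡ rising 3 x (length L)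
sum-splits x []      = refl
sum-splits x (a ∷ L) = begin
  sum (map F (map (map₁ (a ∷_)) (splits L) ++ map (map₂ (a ∷_)) (splits L)))
    ≡⟨ sum-map-++ F (map (map₁ (a ∷_)) (splits L)) _ ⟩
  sum (map F (map (map₁ (a ∷_)) (splits L))) + sum (map F (map (map₂ (a ∷_)) (splits L)))
    ≡⟨ cong₂ _+_ (cong sum (map-∘ (splits L))) (cong sum (map-∘ (splits L))) ⟨
  sum (map (F ∘ map₁ (a ∷_)) (splits L)) + sum (map (F ∘ map₂ (a ∷_)) (splits L))
    ≡⟨ sum-map-+ (F ∘ map₁ (a ∷_)) (F ∘ map₂ (a ∷_)) (splits L) ⟨
  sum (map (λ UC → F (map₁ (a ∷_) UC) + F (map₂ (a ∷_) UC)) (splits L))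
    ≡⟨ sum-map-cong _ (λ UC → (3 + length L * x) * F UC) extend ⟩
  sum (map (λ UC → (3 + length L * x) * F UC) (splits L))
    ≡⟨ sum-map-*ˡ (3 + length L * x) F (splits L) ⟩
  (3 + length L * x) * sum (map F (splits L))
    ≡⟨ cong ((3 + length L * x) *_) (sum-splits x L) ⟩
  rising 3 x (length (a ∷ L)) ∎
  where
  open ≡-Reasoning
  F : List A × List A → ℕ
  F (U , C) = rising 1 x (length U) * rising 2 x (length C)
  recurrence : ∀ y u c p q → (1 + u * y) * p * q + p * ((2 + c * y) * q) ≡ (3 + (u + c) * y) * (p * q)
  recurrence = solve-∀
  extend : ∀ {UC} → UC ∈ splits L → F (map₁ (a ∷_) UC) + F (map₂ (a ∷_) UC) ≡ (3 + length L * x) * F UC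
  extend {U , C} UC∈ rewrite sym (trans (sym (length-++ U)) (↭-length (splits-↭ L UC∈))) =
    recurrence x (length U) (length C) (rising 1 x (length U)) (rising 2 x (length C))

mmpGo-before1 : ∀ n pre P W → All (λ a → 1 < a × a < n) P → n ∈ W →
                mmpGo pre (P ++ 1 ∷ W) ≡ nonLeftMinima pre P + mmpGo (pre ++ P) (1 ∷ W)
mmpGo-before1 n pre []      W _ _ rewrite ++-identityʳ pre = refl
mmpGo-before1 n pre (a ∷ P) W ((1<a , a<n) ∷ inP) n∈W
  rewrite any-true (λ b → a <ᵇ b) (P ++ 1 ∷ W) (∈-++⁺ʳ P (there n∈W)) (<ᵇ-true a<n)
        | any-true (λ b → b <ᵇ a) (P ++ 1 ∷ W) (∈-++⁺ʳ P (here refl)) (<ᵇ-true 1<a)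
        | ∧-identityʳ (any (λ b → b <ᵇ a) pre)
        | mmpGo-before1 n (pre ++ [ a ]) P W inP n∈W
        | ++-assoc pre [ a ] P
  = sym (+-assoc (indicator (any (λ b → b <ᵇ a) pre)) _ _)

mmpGo-1∷ : ∀ pre W → All (1 <_) W → mmpGo pre (1 ∷ W) ≡ mmpGo (pre ++ [ 1 ]) W
mmpGo-1∷ pre W 1<W rewrite any-false (λ b → b <ᵇ 1) (<ᵇ-false ∘ <⇒≤ ∘ All.lookup 1<W)
                         | ∧-zeroʳ (any (λ b → 1 <ᵇ b) W) | ∧-zeroʳ (any (λ b → b <ᵇ 1) pre) = refl

mmpGo-after1 : ∀ pre W → 1 ∈ pre → All (1 <_) W → mmpGo pre W ≡ rightSandwiched W
mmpGo-after1 pre []      _    _           = refl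
mmpGo-after1 pre (a ∷ W) 1∈pre (1<a ∷ 1<W) rewrite any-true (λ b → b <ᵇ a) pre 1∈pre (<ᵇ-true 1<a) =
  cong (_ +_) (mmpGo-after1 (pre ++ [ a ]) W (∈-++⁺ˡ 1∈pre) 1<W)

mmp-around1 : ∀ n P W → All (λ a → 1 < a × a < n) P → n ∈ W → All (1 <_) W →
              mmp (P ++ 1 ∷ W) ≡ nonLeftMinima [] P + rightSandwiched W
mmp-around1 n P W inP n∈W 1<W = begin
  mmpGo [] (P ++ 1 ∷ W)                        ≡⟨ mmpGo-before1 n [] P W inP n∈W ⟩
  nonLeftMinima [] P + mmpGo P (1 ∷ W)         ≡⟨ cong (nonLeftMinima [] P +_) (mmpGo-1∷ P W 1<W) ⟩
  nonLeftMinima [] P + mmpGo (P ++ [ 1 ]) W    ≡⟨ cong (nonLeftMinima [] P +_)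
                                                      (mmpGo-after1 (P ++ [ 1 ]) W (∈-++⁺ʳ P (here refl)) 1<W) ⟩
  nonLeftMinima [] P + rightSandwiched W       ∎
  where open ≡-Reasoning

oneTo : ℕ → List ℕ
oneTo n = map suc (upTo n)

length-oneTo : ∀ n → length (oneTo n) ≡ n
length-oneTo n = trans (length-map suc (upTo n)) (length-upTo n)

Unique-oneTo : ∀ n → Unique (oneTo n)
Unique-oneTo n = Unique.map⁺ suc-injective (Unique.upTo⁺ n)

∈-words⁻ : ∀ k n {σ} → σ ∈ words k n → length σ ≡ k × All (_∈ oneTo n) σ
∈-words⁻ zero    n (here refl) = refl , []
∈-words⁻ (suc k) n σ∈
  with w , w∈ , σ∈′ ← find (∈-concatMap⁻ _ {xs = words k n} σ∈)
  with a , a∈ , refl ← ∈-map⁻ _ σ∈′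
  with |w| , w⊆ ← ∈-words⁻ k n w∈ = cong suc |w| , a∈ ∷ w⊆

∈-words⁺ : ∀ k n {σ} → length σ ≡ k → All (_∈ oneTo n) σ → σ ∈ words k n
∈-words⁺ zero    n {[]}    _   []         = here refl
∈-words⁺ (suc k) n {a ∷ w} |σ| (a∈ ∷ w⊆) =
  ∈-concatMap⁺ _ {xs = words k n} (lose (∈-words⁺ k n (suc-injective |σ|) w⊆) (∈-map⁺ (_∷ w) a∈))

Unique-words : ∀ k n → Unique (words k n)
Unique-words zero    n = [] ∷ []
Unique-words (suc k) n =
  Unique-concatMap⁺ _ drop-head id (subst Unique (sym (map-id (words k n))) (Unique-words k n))
    (λ _ → Unique.map⁺ ∷-injectiveˡ (Unique-oneTo n)) (λ _ σ∈ → drop-head-∷ σ∈)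
  where
  drop-head : List ℕ → List ℕ
  drop-head []      = []
  drop-head (_ ∷ w) = w
  drop-head-∷ : ∀ {w : List ℕ} {as σ} → σ ∈ map (_∷ w) as → drop-head σ ≡ w
  drop-head-∷ σ∈ with _ , _ , refl ← ∈-map⁻ _ σ∈ = refl

distinct⇒Unique : ∀ σ → T (distinct σ) → Unique σ
distinct⇒Unique []      _ = []
distinct⇒Unique (a ∷ w) d with any (λ b → a ≡ᵇ b) w in eq
... | false = All.tabulate (λ b∈w a≡b → no-repeat b∈w a≡b) ∷ distinct⇒Unique w d
  where
  no-repeat : ∀ {b} → b ∈ w → a ≢ b
  no-repeat b∈w refl with () ← trans (sym eq) (any-true (λ c → a ≡ᵇ c) w b∈w (≡ᵇ-refl a))

Unique⇒distinct : ∀ σ → Unique σ → T (distinct σ)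
Unique⇒distinct []      _          = _
Unique⇒distinct (a ∷ w) (a∉w ∷ uw) rewrite any-false (λ b → a ≡ᵇ b) (≡ᵇ-false ∘ All.lookup a∉w) = Unique⇒distinct w uw

Unique-⊆-length⇒↭ : {xs ys : List A} → Unique xs → All (_∈ ys) xs → length ys ≤ length xs → xs ↭ ys
Unique-⊆-length⇒↭ {xs = []}     {[]}    _          _          _   = ↭-refl
Unique-⊆-length⇒↭ {xs = x ∷ xs} {ys}    (x∉xs ∷ u) (x∈ys ∷ xs⊆) |ys|≤
  with ys₁ , ys₂ , refl ← ∈-∃++ x∈ys =
  ↭-trans (↭-prep x (Unique-⊆-length⇒↭ u (All.tabulate (λ {b} b∈xs → removeX b∈xs)) |ys₁++ys₂|≤))
          (↭-sym (shift x ys₁ ys₂))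
  where
  removeX : ∀ {b} → b ∈ xs → b ∈ ys₁ ++ ys₂
  removeX {b} b∈xs with ∈-++⁻ ys₁ (All.lookup xs⊆ b∈xs)
  ... | inj₁ b∈ys₁         = ∈-++⁺ˡ b∈ys₁
  ... | inj₂ (here refl)   = ⊥-elim (All.lookup x∉xs b∈xs refl)
  ... | inj₂ (there b∈ys₂) = ∈-++⁺ʳ ys₁ b∈ys₂
  |ys₁++ys₂|≤ : length (ys₁ ++ ys₂) ≤ length xs
  |ys₁++ys₂|≤ = ≤-pred (subst (_≤ suc (length xs)) (↭-length (shift x ys₁ ys₂)) |ys|≤)

∈-Sn⁻ : ∀ n {σ} → σ ∈ Sn n → σ ↭ oneTo n
∈-Sn⁻ n {σ} σ∈ with σ∈words , d ← ∈-filter⁻ (T? ∘ distinct) {xs = words n n} σ∈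
               with |σ| , σ⊆ ← ∈-words⁻ n n σ∈words =
  Unique-⊆-length⇒↭ (distinct⇒Unique σ d) σ⊆ (≤-reflexive (trans (length-oneTo n) (sym |σ|)))

∈-Sn⁺ : ∀ n {σ} → σ ↭ oneTo n → σ ∈ Sn n
∈-Sn⁺ n {σ} σ↭ = ∈-filter⁺ (T? ∘ distinct)
  (∈-words⁺ n n (trans (↭-length σ↭) (length-oneTo n)) (All.tabulate (∈-resp-↭ σ↭)))
  (Unique⇒distinct σ (Unique-resp-↭ (↭-sym σ↭) (Unique-oneTo n)))

∉∷⇒≢ : ∀ {b a : ℕ} {P} → b ∉ a ∷ P → a ≢ b
∉∷⇒≢ b∉ a≡b = b∉ (here (sym a≡b))

oneBefore-intro : ∀ n P W → 1 ∉ P → n ∉ P → oneBefore n (P ++ 1 ∷ W) ≡ true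
oneBefore-intro n []      W _  _  = refl
oneBefore-intro n (a ∷ P) W 1∉ n∉ rewrite ≡ᵇ-false (∉∷⇒≢ 1∉) | ≡ᵇ-false (∉∷⇒≢ n∉) =
  oneBefore-intro n P W (1∉ ∘ there) (n∉ ∘ there)

oneBefore-elim : ∀ n P W → 1 ∉ P → T (oneBefore n (P ++ 1 ∷ W)) → n ∉ P
oneBefore-elim n (a ∷ P) W 1∉ ob n∈aP rewrite ≡ᵇ-false (∉∷⇒≢ 1∉)
  with a ≡ᵇ n in a≡ᵇn | n∈aP
... | true  | _          = ob
... | false | here refl  with () ← trans (sym a≡ᵇn) (≡ᵇ-refl a)
... | false | there n∈P  = oneBefore-elim n P W (1∉ ∘ there) ob n∈P

before1 : List ℕ → List ℕ
before1 []      = []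
before1 (a ∷ s) = if a ≡ᵇ 1 then [] else a ∷ before1 s

before1-++ : ∀ P W → 1 ∉ P → before1 (P ++ 1 ∷ W) ≡ P
before1-++ []      W _  = refl
before1-++ (a ∷ P) W 1∉ rewrite ≡ᵇ-false (∉∷⇒≢ 1∉) = cong (a ∷_) (before1-++ P W (1∉ ∘ there))

↭-filter-split : ∀ {xs ys zs : List ℕ} → Unique (xs ++ ys) → xs ++ ys ↭ zs →
                 xs ↭ filter (_∈? xs) zs × ys ↭ filter (¬? ∘ (_∈? xs)) zs
↭-filter-split {xs} {ys} {zs} u xsys↭zs =
  subst (_↭ filter (_∈? xs) zs) filter-xs (filter-↭ (_∈? xs) xsys↭zs) ,
  subst (_↭ filter (¬? ∘ (_∈? xs)) zs) filter-ys (filter-↭ (¬? ∘ (_∈? xs)) xsys↭zs)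
  where
  disjoint : ∀ {a} → a ∈ ys → a ∉ xs
  disjoint a∈ys a∈xs = Unique-++⇒disjoint xs u a∈xs a∈ys
  filter-xs : filter (_∈? xs) (xs ++ ys) ≡ xs
  filter-xs = begin
    filter (_∈? xs) (xs ++ ys)                   ≡⟨ filter-++ (_∈? xs) xs ys ⟩
    filter (_∈? xs) xs ++ filter (_∈? xs) ys     ≡⟨ cong₂ _++_ (filter-all (_∈? xs) (All.tabulate id))
                                                                (filter-none (_∈? xs) (All.tabulate disjoint)) ⟩
    xs ++ []                                     ≡⟨ ++-identityʳ xs ⟩
    xs                                           ∎
    where open ≡-Reasoning
  filter-ys : filter (¬? ∘ (_∈? xs)) (xs ++ ys) ≡ ys
  filter-ys = begin
    filter (¬? ∘ (_∈? xs)) (xs ++ ys)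
      ≡⟨ filter-++ (¬? ∘ (_∈? xs)) xs ys ⟩
    filter (¬? ∘ (_∈? xs)) xs ++ filter (¬? ∘ (_∈? xs)) ys
      ≡⟨ cong₂ _++_ (filter-none (¬? ∘ (_∈? xs)) (All.tabulate (λ a∈xs a∉xs → a∉xs a∈xs)))
                    (filter-all (¬? ∘ (_∈? xs)) (All.tabulate disjoint)) ⟩
    ys ∎
    where open ≡-Reasoning

module Enumeration (m : ℕ) where

  n : ℕ
  n = 2 + m

  L : List ℕ
  L = applyUpTo (2 +_) m

  ∈L⇒bounds : ∀ {a} → a ∈ L → 1 < a × a < n
  ∈L⇒bounds a∈L with i , i<m , refl ← ∈-applyUpTo⁻ (2 +_) a∈L = s≤s (s≤s z≤n) , +-monoʳ-< 2 i<m

  Sorted-L : Sorted L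
  Sorted-L = AllPairs.applyUpTo⁺₁ (2 +_) m (λ i<j _ → +-monoʳ-< 2 i<j)

  oneTo-n : oneTo n ≡ 1 ∷ L ++ [ n ]
  oneTo-n = trans (map-upTo suc n) (cong (1 ∷_) (sym (applyUpTo-∷ʳ (2 +_) m)))

  Unique-1Ln : Unique (1 ∷ L ++ [ n ])
  Unique-1Ln = subst Unique oneTo-n (Unique-oneTo n)

  -- σ = P ++ 1 ∷ W is listed under the split (U , C) of L into the entries before and after 1.
  withPrefix : List ℕ → List ℕ → List (List ℕ)
  withPrefix C P = map (λ W → P ++ 1 ∷ W) (permutations (C ++ [ n ]))

  arrangementsOver : List ℕ × List ℕ → List (List ℕ)
  arrangementsOver (U , C) = concatMap (withPrefix C) (map reverse (permutations U))

  arrangements : List (List ℕ)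
  arrangements = concatMap arrangementsOver (splits L)

  ∈-reversedPermutations⁻ : ∀ {U P : List ℕ} → P ∈ map reverse (permutations U) → P ↭ U
  ∈-reversedPermutations⁻ P∈ with ρ , ρ∈ , refl ← ∈-map⁻ reverse P∈ = ↭-trans (↭-reverse ρ) (∈-permutations⁻ ρ∈)

  ∈-reversedPermutations⁺ : ∀ {U P : List ℕ} → P ↭ U → P ∈ map reverse (permutations U)
  ∈-reversedPermutations⁺ {U} {P} P↭U = subst (_∈ map reverse (permutations U)) (reverse-involutive P)
    (∈-map⁺ reverse (∈-permutations⁺ (↭-trans (↭-reverse P) P↭U)))

  ∈-arrangementsOver⁻ : ∀ {U C σ} → σ ∈ arrangementsOver (U , C) →
                        ∃₂ λ P W → P ↭ U × W ↭ C ++ [ n ] × σ ≡ P ++ 1 ∷ W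
  ∈-arrangementsOver⁻ {U} {C} σ∈
    with P , P∈ , σ∈′ ← find (∈-concatMap⁻ (withPrefix C) {xs = map reverse (permutations U)} σ∈)
    with W , W∈ , refl ← ∈-map⁻ _ σ∈′ = P , W , ∈-reversedPermutations⁻ P∈ , ∈-permutations⁻ W∈ , refl

  ∈-arrangements⁺ : ∀ {U C P W} → (U , C) ∈ splits L → P ↭ U → W ↭ C ++ [ n ] → P ++ 1 ∷ W ∈ arrangements
  ∈-arrangements⁺ {U} {C} {P} UC∈ P↭U W↭ = ∈-concatMap⁺ arrangementsOver {xs = splits L} (lose UC∈
    (∈-concatMap⁺ (withPrefix C) {xs = map reverse (permutations U)} (lose (∈-reversedPermutations⁺ P↭U)
      (∈-map⁺ (λ W → P ++ 1 ∷ W) (∈-permutations⁺ W↭)))))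

  prefix-bounds : ∀ {U C P} → (U , C) ∈ splits L → P ↭ U → All (λ a → 1 < a × a < n) P
  prefix-bounds UC∈ P↭U = All.tabulate (∈L⇒bounds ∘ splits-⊆ˡ L UC∈ ∘ ∈-resp-↭ P↭U)

  suffix-bounds : ∀ {U C W} → (U , C) ∈ splits L → W ↭ C ++ [ n ] → All (1 <_) W
  suffix-bounds {C = C} UC∈ W↭ = All.tabulate (λ a∈W → bound (∈-++⁻ C (∈-resp-↭ W↭ a∈W)))
    where
    bound : ∀ {a} → a ∈ C ⊎ a ∈ [ n ] → 1 < a
    bound (inj₁ a∈C)       = proj₁ (∈L⇒bounds (splits-⊆ʳ L UC∈ a∈C))
    bound (inj₂ (here refl)) = s≤s (s≤s z≤n)

  Sorted-suffix : ∀ {U C} → (U , C) ∈ splits L → Sorted (C ++ [ n ])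
  Sorted-suffix UC∈ = AllPairs.++⁺ (proj₂ (splits-Sorted L Sorted-L UC∈)) ([] ∷ [])
    (All.tabulate (λ a∈C → proj₂ (∈L⇒bounds (splits-⊆ʳ L UC∈ a∈C)) ∷ []))

  ∈-arrangements⇒∈-Sn1n : ∀ {σ} → σ ∈ arrangements → σ ∈ Sn1n n
  ∈-arrangements⇒∈-Sn1n σ∈
    with (U , C) , UC∈ , σ∈′ ← find (∈-concatMap⁻ arrangementsOver {xs = splits L} σ∈)
    with P , W , P↭U , W↭ , refl ← ∈-arrangementsOver⁻ σ∈′ =
    ∈-filter⁺ (T? ∘ oneBefore n) (∈-Sn⁺ n σ↭) (Equivalence.from T-≡ (oneBefore-intro n P W 1∉P n∉P))
    where
    σ↭ : P ++ 1 ∷ W ↭ oneTo n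
    σ↭ = subst (P ++ 1 ∷ W ↭_) (sym oneTo-n)
      (↭-trans (++⁺ P↭U (↭-prep 1 W↭)) (↭-trans (shift 1 U (C ++ [ n ]))
        (↭-prep 1 (subst (_↭ L ++ [ n ]) (++-assoc U C [ n ]) (++⁺ʳ [ n ] (splits-↭ L UC∈))))))
    1∉P : 1 ∉ P
    1∉P 1∈P = <-irrefl refl (proj₁ (All.lookup (prefix-bounds UC∈ P↭U) 1∈P))
    n∉P : n ∉ P
    n∉P n∈P = <-irrefl refl (proj₂ (All.lookup (prefix-bounds UC∈ P↭U) n∈P))

  ∈-Sn1n⇒∈-arrangements : ∀ {σ} → σ ∈ Sn1n n → σ ∈ arrangements
  ∈-Sn1n⇒∈-arrangements {σ} σ∈ with σ∈Sn , ob ← ∈-filter⁻ (T? ∘ oneBefore n) {xs = Sn n} σ∈ = split (∈-∃++ 1∈σ)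
    where
    σ↭ : σ ↭ 1 ∷ L ++ [ n ]
    σ↭ = subst (σ ↭_) oneTo-n (∈-Sn⁻ n σ∈Sn)
    1∈σ : 1 ∈ σ
    1∈σ = ∈-resp-↭ (↭-sym σ↭) (here refl)
    split : (∃₂ λ P W → σ ≡ P ++ [ 1 ] ++ W) → σ ∈ arrangements
    split (P , W , refl) = ∈-arrangements⁺ (filter-∈-splits (_∈? P) L)
      (subst (P ↭_) prefix-filter (proj₁ parts)) (subst (W ↭_) suffix-filter (proj₂ parts))
      where
      1∉P : 1 ∉ P
      1∉P 1∈P = Unique-++⇒disjoint P (Unique-resp-↭ (↭-sym σ↭) Unique-1Ln) 1∈P (here refl)
      n∉P : n ∉ P
      n∉P = oneBefore-elim n P W 1∉P ob
      1PW↭ : 1 ∷ P ++ W ↭ 1 ∷ L ++ [ n ]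
      1PW↭ = ↭-trans (↭-sym (shift 1 P W)) σ↭
      parts : P ↭ filter (_∈? P) (L ++ [ n ]) × W ↭ filter (¬? ∘ (_∈? P)) (L ++ [ n ])
      parts with _ ∷ uPW ← Unique-resp-↭ (↭-sym 1PW↭) Unique-1Ln = ↭-filter-split uPW (drop-∷ 1PW↭)
      prefix-filter : filter (_∈? P) (L ++ [ n ]) ≡ filter (_∈? P) L
      prefix-filter = trans (filter-++ (_∈? P) L [ n ])
        (trans (cong (filter (_∈? P) L ++_) (filter-reject (_∈? P) n∉P)) (++-identityʳ _))
      suffix-filter : filter (¬? ∘ (_∈? P)) (L ++ [ n ]) ≡ filter (¬? ∘ (_∈? P)) L ++ [ n ]
      suffix-filter = trans (filter-++ (¬? ∘ (_∈? P)) L [ n ])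
        (cong (filter (¬? ∘ (_∈? P)) L ++_) (filter-accept (¬? ∘ (_∈? P)) n∉P))

  splitOf : List ℕ → List ℕ × List ℕ
  splitOf σ = filter (_∈? before1 σ) L , filter (¬? ∘ (_∈? before1 σ)) L

  Unique-arrangementsOver : ∀ {U C} → (U , C) ∈ splits L → Unique (arrangementsOver (U , C))
  Unique-arrangementsOver {U} {C} UC∈ =
    Unique-concatMap⁺ (withPrefix C) before1 id
      (subst Unique (sym (map-id _)) (Unique.map⁺ reverse-injective (Unique-permutations uU)))
      (λ {P} _ → Unique.map⁺ (∷-injectiveʳ ∘ ++-cancelˡ P _ _) (Unique-permutations (Sorted⇒Unique (Sorted-suffix UC∈))))
      (λ P∈ σ∈ → before1-prefix P∈ σ∈)
    where
    uU : Unique U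
    uU = Sorted⇒Unique (proj₁ (splits-Sorted L Sorted-L UC∈))
    before1-prefix : ∀ {P σ} → P ∈ map reverse (permutations U) → σ ∈ withPrefix C P → before1 σ ≡ P
    before1-prefix {P} P∈ σ∈ with W , _ , refl ← ∈-map⁻ _ σ∈ =
      before1-++ P W (λ 1∈P → <-irrefl refl (proj₁ (All.lookup (prefix-bounds UC∈ (∈-reversedPermutations⁻ P∈)) 1∈P)))

  splitOf-arrangementsOver : ∀ {U C σ} → (U , C) ∈ splits L → σ ∈ arrangementsOver (U , C) → splitOf σ ≡ (U , C)
  splitOf-arrangementsOver {U} {C} UC∈ σ∈ with P , W , P↭U , _ , refl ← ∈-arrangementsOver⁻ {U} {C} σ∈
    rewrite before1-++ P W (λ 1∈P → <-irrefl refl (proj₁ (All.lookup (prefix-bounds UC∈ P↭U) 1∈P))) =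
    splits-filter-≡ (_∈? P) L (Sorted⇒Unique Sorted-L) UC∈ (λ _ → mk⇔ (∈-resp-↭ P↭U) (∈-resp-↭ (↭-sym P↭U)))

  Unique-arrangements : Unique arrangements
  Unique-arrangements = Unique-concatMap⁺ arrangementsOver splitOf id
    (subst Unique (sym (map-id _)) (Unique-splits (Sorted⇒Unique Sorted-L)))
    Unique-arrangementsOver splitOf-arrangementsOver

  Unique-Sn1n : Unique (Sn1n n)
  Unique-Sn1n = Unique.filter⁺ (T? ∘ oneBefore n) (Unique.filter⁺ (T? ∘ distinct) (Unique-words n n))

  Sn1n↭arrangements : Sn1n n ↭ arrangements
  Sn1n↭arrangements = ↭-of-Unique Unique-Sn1n Unique-arrangements (mk⇔ ∈-Sn1n⇒∈-arrangements ∈-arrangements⇒∈-Sn1n)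

  module _ (x : ℕ) where

    sum-withPrefix : ∀ {U C P} → (U , C) ∈ splits L → P ↭ U →
      sum (map (λ σ → x ^ mmp σ) (withPrefix C P)) ≡ rising 2 x (length C) * x ^ nonLeftMinima [] P
    sum-withPrefix {U} {C} {P} UC∈ P↭U = begin
      sum (map (λ σ → x ^ mmp σ) (map (λ W → P ++ 1 ∷ W) (permutations (C ++ [ n ]))))
        ≡⟨ cong sum (map-∘ (permutations (C ++ [ n ]))) ⟨
      sum (map (λ W → x ^ mmp (P ++ 1 ∷ W)) (permutations (C ++ [ n ])))
        ≡⟨ sum-map-cong _ (λ W → x ^ nonLeftMinima [] P * x ^ rightSandwiched W) split-mmp ⟩
      sum (map (λ W → x ^ nonLeftMinima [] P * x ^ rightSandwiched W) (permutations (C ++ [ n ])))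
        ≡⟨ sum-map-*ˡ (x ^ nonLeftMinima [] P) (λ W → x ^ rightSandwiched W) (permutations (C ++ [ n ])) ⟩
      x ^ nonLeftMinima [] P * sum (map (λ W → x ^ rightSandwiched W) (permutations (C ++ [ n ])))
        ≡⟨ cong (x ^ nonLeftMinima [] P *_) sum-suffix ⟩
      x ^ nonLeftMinima [] P * rising 2 x (length C)
        ≡⟨ *-comm (x ^ nonLeftMinima [] P) _ ⟩
      rising 2 x (length C) * x ^ nonLeftMinima [] P ∎
      where
      open ≡-Reasoning
      |C++n| : length (C ++ [ n ]) ≡ suc (length C)
      |C++n| = trans (length-++ C) (+-comm (length C) 1)
      split-mmp : ∀ {W} → W ∈ permutations (C ++ [ n ]) → x ^ mmp (P ++ 1 ∷ W) ≡ x ^ nonLeftMinima [] P * x ^ rightSandwiched W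
      split-mmp {W} W∈ = trans
        (cong (x ^_) (mmp-around1 n P W (prefix-bounds UC∈ P↭U)
          (∈-resp-↭ (↭-sym (∈-permutations⁻ W∈)) (∈-++⁺ʳ C (here refl))) (suffix-bounds UC∈ (∈-permutations⁻ W∈))))
        (^-distribˡ-+-* x (nonLeftMinima [] P) (rightSandwiched W))
      sum-suffix : sum (map (λ W → x ^ rightSandwiched W) (permutations (C ++ [ n ]))) ≡ rising 2 x (length C)
      sum-suffix = trans (cong (λ k → sum (map (λ W → x ^ rightSandwiched W) (permutationsOfLength k (C ++ [ n ])))) |C++n|)
                         (sum-rightSandwiched x (length C) (C ++ [ n ]) (Sorted-suffix UC∈) |C++n|)

    sum-arrangementsOver : ∀ {U C} → (U , C) ∈ splits L →
      sum (map (λ σ → x ^ mmp σ) (arrangementsOver (U , C))) ≡ rising 1 x (length U) * rising 2 x (length C)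
    sum-arrangementsOver {U} {C} UC∈ = begin
      sum (map (λ σ → x ^ mmp σ) (arrangementsOver (U , C)))
        ≡⟨ sum-map-concatMap _ (withPrefix C) (map reverse (permutations U)) ⟩
      sum (map (λ P → sum (map (λ σ → x ^ mmp σ) (withPrefix C P))) (map reverse (permutations U)))
        ≡⟨ sum-map-cong _ (λ P → rising 2 x (length C) * x ^ nonLeftMinima [] P)
                          (sum-withPrefix UC∈ ∘ ∈-reversedPermutations⁻) ⟩
      sum (map (λ P → rising 2 x (length C) * x ^ nonLeftMinima [] P) (map reverse (permutations U)))
        ≡⟨ sum-map-*ˡ (rising 2 x (length C)) (λ P → x ^ nonLeftMinima [] P) (map reverse (permutations U)) ⟩
      rising 2 x (length C) * sum (map (λ P → x ^ nonLeftMinima [] P) (map reverse (permutations U)))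
        ≡⟨ cong (λ s → rising 2 x (length C) * sum s) (map-∘ (permutations U)) ⟨
      rising 2 x (length C) * sum (map (λ ρ → x ^ nonLeftMinima [] (reverse ρ)) (permutations U))
        ≡⟨ cong (rising 2 x (length C) *_) (sum-nonLeftMinima x (length U) U (proj₁ (splits-Sorted L Sorted-L UC∈)) refl) ⟩
      rising 2 x (length C) * rising 1 x (length U)
        ≡⟨ *-comm (rising 2 x (length C)) _ ⟩
      rising 1 x (length U) * rising 2 x (length C) ∎
      where open ≡-Reasoning

    B≡rising : B n x ≡ rising 3 x m
    B≡rising = begin
      sum (map (λ σ → x ^ mmp σ) (Sn1n n))
        ≡⟨ sum-↭ (map⁺ (λ σ → x ^ mmp σ) Sn1n↭arrangements) ⟩
      sum (map (λ σ → x ^ mmp σ) arrangements)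
        ≡⟨ sum-map-concatMap _ arrangementsOver (splits L) ⟩
      sum (map (λ UC → sum (map (λ σ → x ^ mmp σ) (arrangementsOver UC))) (splits L))
        ≡⟨ sum-map-cong _ (λ (U , C) → rising 1 x (length U) * rising 2 x (length C)) sum-arrangementsOver ⟩
      sum (map (λ (U , C) → rising 1 x (length U) * rising 2 x (length C)) (splits L))
        ≡⟨ sum-splits x L ⟩
      rising 3 x (length L)
        ≡⟨ cong (rising 3 x) (length-applyUpTo (2 +_) m) ⟩
      rising 3 x m ∎
      where open ≡-Reasoning

mainTheorem16 : (m x : ℕ) → B (m + 2) x ≡ rhsProd m x
mainTheorem16 m x = begin
  B (m + 2) x   ≡⟨ cong (λ n → B n x) (+-comm m 2) ⟩
  B (2 + m) x   ≡⟨ Enumeration.B≡rising m x ⟩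
  rising 3 x m  ≡⟨ rising-product 3 x m ⟨
  rhsProd m x   ∎
  where open ≡-Reasoning
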